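{- Let $s\ge 1$, $L\ge 2s^3+5s^2+1$, $L\le k\le s+L$ and $n\ge 2s^5+8s^4+s^3-14s^2+3s+1$ be integers. There is an injection $\phi_2:C^2_{L,s,2}(n)\to F^2_{L,s,k}(n)$.
   Context: $C_{L,s,2}(n)$ is the set of partitions of $n$ with all parts in $\{s+1,\ldots,s+L\}$; for such a partition, $f_i$ denotes the number of parts equal to $i$. $F_{L,s,k}(n)$ is the set of partitions of $n$ with smallest part equal to $s$, largest part at most $s+L$, and no part equal to $k$; for such a partition, $g_i$ denotes the number of parts equal to $i$. $C^2_{L,s,2}(n)$ is the set of partitions in $C_{L,s,2}(n)$ with $f_k=0$, $f_{as}=0$ for all integers $a\ge 2$, and such that there exists an integer $j$ with $s+1\le j\le 2s^2+5s-1$ and $f_j\ge s$. $F^2_{L,s,k}(n)$ is the set of partitions in $F_{L,s,k}(n)$ with $g_s=1$ and such that there exists an integer $i\ge 2$ with $g_{is}=1$ and $g_{js}=0$ for all integers $j\ge 1$ with $j\ne 1,i$. -}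

module Defs where

open import Data.Nat using (ℕ; zero; suc; _+_; _*_; _∸_; _^_; _≤_; _<_; _≥_; _≟_)
open import Data.List using (List; length; filter)
open import Data.Nat.ListAction using (sum)
open import Data.List.Relation.Unary.All using (All)
open import Data.List.Relation.Unary.Linked using (Linked)
open import Data.List.Membership.Propositional using (_∈_)
open import Data.Product using (Σ; ∃; ∃-syntax; _×_; proj₁)
open import Relation.Binary.PropositionalEquality using (_≡_)
open import Relation.Nullary using (¬_)

IsPartition : ℕ → List ℕ → Set
IsPartition n ps = Linked _≥_ ps × All (λ p → 1 ≤ p) ps × sum ps ≡ n

mult : ℕ → List ℕ → ℕ
mult i ps = length (filter (_≟ i) ps)

InC : ℕ → ℕ → ℕ → List ℕ → Set
InC L s n ps = IsPartition n ps × All (λ p → s + 1 ≤ p × p ≤ s + L) ps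

-- C^2_{L,s,2}(n) (depends also on k)
InC2 : ℕ → ℕ → ℕ → ℕ → List ℕ → Set
InC2 L s k n ps =
  InC L s n ps
  × mult k ps ≡ 0
  × (∀ a → 2 ≤ a → mult (a * s) ps ≡ 0)
  × (∃[ j ] (s + 1 ≤ j × j ≤ 2 * s ^ 2 + 5 * s ∸ 1 × s ≤ mult j ps))

InF : ℕ → ℕ → ℕ → ℕ → List ℕ → Set
InF L s k n ps =
  IsPartition n ps
  × s ∈ ps
  × All (λ p → s ≤ p × p ≤ s + L) ps
  × mult k ps ≡ 0

InF2 : ℕ → ℕ → ℕ → ℕ → List ℕ → Set
InF2 L s k n ps =
  InF L s k n ps
  × mult s ps ≡ 1
  × (∃[ i ] (2 ≤ i × mult (i * s) ps ≡ 1
             × (∀ j → 1 ≤ j → ¬ j ≡ 1 → ¬ j ≡ i → mult (j * s) ps ≡ 0)))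

C2 : ℕ → ℕ → ℕ → ℕ → Set
C2 L s k n = Σ (List ℕ) (InC2 L s k n)

F2 : ℕ → ℕ → ℕ → ℕ → Set
F2 L s k n = Σ (List ℕ) (InF2 L s k n)

IsInjection : ∀ {L s k n} → (C2 L s k n → F2 L s k n) → Set
IsInjection φ = ∀ x y → proj₁ (φ x) ≡ proj₁ (φ y) → proj₁ x ≡ proj₁ y

module Submission where

-- A partition in C² has a part j with s+1 ≤ j ≤ 2s²+5s−1 occurring at least s
-- times.  Writing j = i+1, we replace s copies of i+1 by one part s and one
-- part i·s (both sum to s(i+1)) and re-sort.  Since s ≤ i and i·s < L ≤ k, the
-- new partition has smallest part s (occurring once), largest part ≤ s+L, no
-- part k, and i·s is its only multiple of s other than s itself, occurring
-- once.  The image therefore determines i, and since the construction only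
-- depends on the multiset of parts, it also determines the original
-- multiset; a decreasingly sorted list is determined by its multiset.

open import Defs
open import Data.Nat using (ℕ; zero; suc; _+_; _*_; _^_; _≤_; _<_; _≥_; _≟_; z≤n; s≤s; NonZero; >-nonZero)
open import Data.Nat.Properties
open import Data.Nat.ListAction using (sum)
open import Data.Nat.ListAction.Properties using (sum-++; sum-↭)
open import Data.List using (List; []; _∷_; _++_; replicate; length; filter)
open import Data.List.Properties using (length-++; filter-++; filter-none; filter-accept; filter-reject)
open import Data.List.Relation.Unary.All as All using (All; _∷_)
import Data.List.Relation.Unary.All.Properties as All
open import Data.List.Relation.Unary.Any using (here)
open import Data.List.Relation.Unary.Linked using (Linked)
open import Data.List.Membership.Propositional using (_∈_)
open import Data.List.Relation.Binary.Permutation.Propositional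
  using (_↭_; ↭-refl; ↭-reflexive; ↭-sym; ↭-trans; prep; swap; ↭⇒↭ₛ; module PermutationReasoning)
open import Data.List.Relation.Binary.Permutation.Propositional.Properties
  using (filter-↭; ↭-length; All-resp-↭; ∈-resp-↭; shift; drop-∷; ++⁺ˡ)
open import Data.List.Relation.Binary.Equality.Propositional using (≋⇒≡)
open import Data.List.Relation.Unary.Sorted.TotalOrder.Properties using (↗↭↗⇒≋)
open import Relation.Binary.Bundles using (DecTotalOrder)
open import Relation.Binary.Properties.DecTotalOrder ≤-decTotalOrder using (≥-decTotalOrder)
open import Data.List.Sort.InsertionSort.Base ≥-decTotalOrder using (sort)
open import Data.List.Sort.InsertionSort.Properties ≥-decTotalOrder using (sort-↭; sort-↗)
open import Data.Product using (Σ; _×_; _,_; proj₁; proj₂)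
open import Data.Empty using (⊥-elim)
open import Relation.Nullary using (¬_; yes; no; contradiction)
open import Relation.Binary.PropositionalEquality
open import Data.Nat.Solver using (module +-*-Solver)

Decreasing : List ℕ → Set
Decreasing = Linked _≥_

mult-hit : ∀ b xs → mult b (b ∷ xs) ≡ suc (mult b xs)
mult-hit b xs = cong length (filter-accept (_≟ b) refl)

mult-miss : ∀ {x b} xs → ¬ x ≡ b → mult b (x ∷ xs) ≡ mult b xs
mult-miss {b = b} xs x≢b = cong length (filter-reject (_≟ b) x≢b)

mult-++ : ∀ b xs ys → mult b (xs ++ ys) ≡ mult b xs + mult b ys
mult-++ b xs ys = trans (cong length (filter-++ (_≟ b) xs ys)) (length-++ (filter (_≟ b) xs))

mult-↭ : ∀ b {xs ys} → xs ↭ ys → mult b xs ≡ mult b ys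
mult-↭ b p = ↭-length (filter-↭ (_≟ b) p)

mult-absent : ∀ b {xs} → All (λ p → ¬ p ≡ b) xs → mult b xs ≡ 0
mult-absent b h = cong length (filter-none (_≟ b) h)

mult-front : ∀ {b c} zs → ¬ c ≡ b → mult b zs ≡ 0 → mult b (b ∷ c ∷ zs) ≡ 1
mult-front {b} zs c≢b absent =
  trans (mult-hit b _) (cong suc (trans (mult-miss zs c≢b) absent))

mult-second : ∀ {b c} zs → ¬ b ≡ c → mult c zs ≡ 0 → mult c (b ∷ c ∷ zs) ≡ 1
mult-second {b} {c} zs b≢c absent =
  trans (mult-↭ c (swap b c ↭-refl)) (mult-front zs b≢c absent)

decreasing-↭-unique : ∀ {xs ys} → Decreasing xs → Decreasing ys → xs ↭ ys → xs ≡ ys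
decreasing-↭-unique xs↘ ys↘ p = ≋⇒≡ (↗↭↗⇒≋ (DecTotalOrder.totalOrder ≥-decTotalOrder) xs↘ ys↘ (↭⇒↭ₛ p))

removeN : ℕ → ℕ → List ℕ → List ℕ
removeN zero    j xs       = xs
removeN (suc t) j []       = []
removeN (suc t) j (x ∷ xs) with x ≟ j
... | yes _ = removeN t j xs
... | no  _ = x ∷ removeN (suc t) j xs

removeN-↭ : ∀ t j xs → t ≤ mult j xs → xs ↭ replicate t j ++ removeN t j xs
removeN-↭ zero    j xs       _      = ↭-refl
removeN-↭ (suc t) j []       ()
removeN-↭ (suc t) j (x ∷ xs) enough with x ≟ j
... | yes refl = prep x (removeN-↭ t x xs (≤-pred (subst (suc t ≤_) (mult-hit x xs) enough)))
... | no  x≢j  = ↭-trans (prep x (removeN-↭ (suc t) j xs enough′))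
                         (↭-sym (shift x (replicate (suc t) j) (removeN (suc t) j xs)))
  where enough′ = subst (suc t ≤_) (mult-miss xs x≢j) enough

removeN-mult : ∀ b t j xs → t ≤ mult j xs → mult b (removeN t j xs) ≤ mult b xs
removeN-mult b t j xs enough = begin
  mult b (removeN t j xs)                                   ≤⟨ m≤n+m _ _ ⟩
  mult b (replicate t j) + mult b (removeN t j xs)          ≡⟨ mult-++ b (replicate t j) _ ⟨
  mult b (replicate t j ++ removeN t j xs)                  ≡⟨ mult-↭ b (removeN-↭ t j xs enough) ⟨
  mult b xs                                                 ∎
  where open ≤-Reasoning

sum-replicate : ∀ t j → sum (replicate t j) ≡ t * j
sum-replicate zero    j = refl
sum-replicate (suc t) j = cong (j +_) (sum-replicate t j)

removeN-sum : ∀ t j xs → t ≤ mult j xs → sum xs ≡ t * j + sum (removeN t j xs)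
removeN-sum t j xs enough = begin
  sum xs                                          ≡⟨ sum-↭ (removeN-↭ t j xs enough) ⟩
  sum (replicate t j ++ removeN t j xs)           ≡⟨ sum-++ (replicate t j) _ ⟩
  sum (replicate t j) + sum (removeN t j xs)      ≡⟨ cong (_+ sum (removeN t j xs)) (sum-replicate t j) ⟩
  t * j + sum (removeN t j xs)                    ∎
  where open ≡-Reasoning

removeN-All : ∀ {P : ℕ → Set} t j xs → t ≤ mult j xs → All P xs → All P (removeN t j xs)
removeN-All t j xs enough h = All.++⁻ʳ (replicate t j) (All-resp-↭ (removeN-↭ t j xs enough) h)

transfer : ℕ → ℕ → List ℕ → List ℕ
transfer s i xs = sort (s ∷ i * s ∷ removeN s (suc i) xs)

module _ (s i : ℕ) {xs : List ℕ} (enough : s ≤ mult (suc i) xs) where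

  private
    rest : List ℕ
    rest = removeN s (suc i) xs

  transfer-↭ : transfer s i xs ↭ s ∷ i * s ∷ rest
  transfer-↭ = sort-↭ (s ∷ i * s ∷ rest)

  transfer-decreasing : Decreasing (transfer s i xs)
  transfer-decreasing = sort-↗ (s ∷ i * s ∷ rest)

  transfer-∈ : s ∈ transfer s i xs
  transfer-∈ = ∈-resp-↭ (↭-sym transfer-↭) (here refl)

  -- s(i+1) = s + i·s, so the total is unchanged.
  transfer-sum : sum (transfer s i xs) ≡ sum xs
  transfer-sum = begin
    sum (transfer s i xs)         ≡⟨ sum-↭ transfer-↭ ⟩
    s + (i * s + sum rest)        ≡⟨ +-assoc s (i * s) _ ⟨
    suc i * s + sum rest          ≡⟨ cong (_+ sum rest) (*-comm (suc i) s) ⟩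
    s * suc i + sum rest          ≡⟨ removeN-sum s (suc i) xs enough ⟨
    sum xs                        ∎
    where open ≡-Reasoning

  transfer-All : ∀ {P : ℕ → Set} → P s → P (i * s) → All P xs → All P (transfer s i xs)
  transfer-All ps pis h = All-resp-↭ (↭-sym transfer-↭) (ps ∷ pis ∷ removeN-All s (suc i) xs enough h)

  private
    absent-from-rest : ∀ b → mult b xs ≡ 0 → mult b rest ≡ 0
    absent-from-rest b absent = n≤0⇒n≡0 (≤-trans (removeN-mult b s (suc i) xs enough) (≤-reflexive absent))

  transfer-absent : ∀ b → ¬ s ≡ b → ¬ i * s ≡ b → mult b xs ≡ 0 → mult b (transfer s i xs) ≡ 0
  transfer-absent b s≢b is≢b absent = begin
    mult b (transfer s i xs)      ≡⟨ mult-↭ b transfer-↭ ⟩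
    mult b (s ∷ i * s ∷ rest)     ≡⟨ mult-miss _ s≢b ⟩
    mult b (i * s ∷ rest)         ≡⟨ mult-miss _ is≢b ⟩
    mult b rest                   ≡⟨ absent-from-rest b absent ⟩
    0                             ∎
    where open ≡-Reasoning

  transfer-small-once : ¬ i * s ≡ s → mult s xs ≡ 0 → mult s (transfer s i xs) ≡ 1
  transfer-small-once is≢s absent =
    trans (mult-↭ s transfer-↭) (mult-front rest is≢s (absent-from-rest s absent))

  transfer-large-once : ¬ s ≡ i * s → mult (i * s) xs ≡ 0 → mult (i * s) (transfer s i xs) ≡ 1
  transfer-large-once s≢is absent =
    trans (mult-↭ (i * s) transfer-↭) (mult-second rest s≢is (absent-from-rest (i * s) absent))

transfer-injective : ∀ s i {xs ys} → Decreasing xs → Decreasing ys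
  → s ≤ mult (suc i) xs → s ≤ mult (suc i) ys
  → transfer s i xs ≡ transfer s i ys → xs ≡ ys
transfer-injective s i {xs} {ys} xs↘ ys↘ enough-x enough-y eq =
  decreasing-↭-unique xs↘ ys↘ (begin
    xs                                             ↭⟨ removeN-↭ s (suc i) xs enough-x ⟩
    replicate s (suc i) ++ removeN s (suc i) xs    ↭⟨ ++⁺ˡ (replicate s (suc i)) rests ⟩
    replicate s (suc i) ++ removeN s (suc i) ys    ↭⟨ ↭-sym (removeN-↭ s (suc i) ys enough-y) ⟩
    ys                                             ∎)
  where
  open PermutationReasoning
  rests : removeN s (suc i) xs ↭ removeN s (suc i) ys
  rests = drop-∷ (drop-∷ (↭-trans (↭-sym (transfer-↭ s i enough-x))
                          (↭-trans (↭-reflexive eq) (transfer-↭ s i enough-y))))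

2≤-unless-1 : ∀ {j} → 1 ≤ j → ¬ j ≡ 1 → 2 ≤ j
2≤-unless-1 {suc zero}    _ j≢1 = contradiction refl j≢1
2≤-unless-1 {suc (suc _)} _ _   = s≤s (s≤s z≤n)

F2-row-unique : ∀ {s i i′ ps} → 2 ≤ i → mult (i * s) ps ≡ 1
  → (∀ j → 1 ≤ j → ¬ j ≡ 1 → ¬ j ≡ i′ → mult (j * s) ps ≡ 0) → i ≡ i′
F2-row-unique {i = i} {i′} 2≤i once others with i ≟ i′
... | yes i≡i′ = i≡i′
... | no  i≢i′ = contradiction (trans (sym once) (others i (≤-trans (s≤s z≤n) 2≤i) i≢1 i≢i′)) λ ()
  where
  i≢1 : ¬ i ≡ 1
  i≢1 refl = contradiction 2≤i λ { (s≤s ()) }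

Source : ℕ → ℕ → List ℕ → Set
Source L s ps = Σ ℕ λ i → s ≤ i × i * s < L × s ≤ mult (suc i) ps

-- Every element of C² has a source row: the part j = i+1 of its definition.
source : ∀ {L s k n} → 2 * s ^ 3 + 5 * s ^ 2 + 1 ≤ L → (x : C2 L s k n) → Source L s (proj₁ x)
source {s = s} _ (_ , _ , _ , _ , zero , s+1≤0 , _) = contradiction (≤-trans (m≤n+m 1 s) s+1≤0) λ ()
source {L} {s} hL (_ , _ , _ , _ , suc i , s+1≤j , j≤ , copies) = i , s≤i , is<L , copies
  where
  open +-*-Solver
  s≤i : s ≤ i
  s≤i = ≤-pred (subst (_≤ suc i) (+-comm s 1) s+1≤j)
  i≤ : i ≤ 2 * s ^ 2 + 5 * s
  i≤ = ≤-trans (n≤1+n i) (≤-trans j≤ (m∸n≤m _ 1))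
  -- i ≤ 2s²+5s, so i·s ≤ 2s³+5s² < L.
  cube : (2 * s ^ 2 + 5 * s) * s ≡ 2 * s ^ 3 + 5 * s ^ 2
  cube = solve 1 (λ s → (con 2 :* s :^ 2 :+ con 5 :* s) :* s := con 2 :* s :^ 3 :+ con 5 :* s :^ 2) refl s
  is<L : i * s < L
  is<L = begin-strict
    i * s                        ≤⟨ *-monoˡ-≤ s i≤ ⟩
    (2 * s ^ 2 + 5 * s) * s      ≡⟨ cube ⟩
    2 * s ^ 3 + 5 * s ^ 2        <⟨ m<m+n _ (s≤s z≤n) ⟩
    2 * s ^ 3 + 5 * s ^ 2 + 1    ≤⟨ hL ⟩
    L                            ∎
    where open ≤-Reasoning

module Construction (s L k n : ℕ) (2≤s : 2 ≤ s)
                    (hL : 2 * s ^ 3 + 5 * s ^ 2 + 1 ≤ L) (L≤k : L ≤ k) where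

  1≤s : 1 ≤ s
  1≤s = ≤-trans (s≤s z≤n) 2≤s

  instance
    s-nonZero : NonZero s
    s-nonZero = >-nonZero 1≤s

  row : C2 L s k n → ℕ
  row x = proj₁ (source hL x)

  image : C2 L s k n → List ℕ
  image x = transfer s (row x) (proj₁ x)

  decreasing : (x : C2 L s k n) → Decreasing (proj₁ x)
  decreasing (_ , ((ps↘ , _) , _) , _) = ps↘

  copies : (x : C2 L s k n) → s ≤ mult (suc (row x)) (proj₁ x)
  copies x = proj₂ (proj₂ (proj₂ (source hL x)))

  2≤row : (x : C2 L s k n) → 2 ≤ row x
  2≤row x = ≤-trans 2≤s (proj₁ (proj₂ (source hL x)))

  row*s<L : (x : C2 L s k n) → row x * s < L
  row*s<L x = proj₁ (proj₂ (proj₂ (source hL x)))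

  -- i ≥ 2 gives s < 2s ≤ i·s.
  s<row*s : (x : C2 L s k n) → s < row x * s
  s<row*s x = <-≤-trans (subst (s <_) (*-comm s 2) (m<m*n s 2 ≤-refl)) (*-monoˡ-≤ s (2≤row x))

  multiples-distinct : ∀ {a b} → ¬ a ≡ b → ¬ a * s ≡ b * s
  multiples-distinct a≢b eq = a≢b (*-cancelʳ-≡ _ _ s eq)

  no-multiples : (x : C2 L s k n) → ∀ a → 2 ≤ a → mult (a * s) (proj₁ x) ≡ 0
  no-multiples (_ , _ , _ , none , _) = none

  row-once : (x : C2 L s k n) → mult (row x * s) (image x) ≡ 1
  row-once x = transfer-large-once s (row x) (copies x)
                 (<⇒≢ (s<row*s x)) (no-multiples x (row x) (2≤row x))

  other-multiples-absent : (x : C2 L s k n)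
    → ∀ j → 1 ≤ j → ¬ j ≡ 1 → ¬ j ≡ row x → mult (j * s) (image x) ≡ 0
  other-multiples-absent x j 1≤j j≢1 j≢i =
    transfer-absent s (row x) (copies x) (j * s)
      (λ s≡js → multiples-distinct j≢1 (trans (sym s≡js) (sym (*-identityˡ s))))
      (≢-sym (multiples-distinct j≢i)) (no-multiples x j (2≤-unless-1 1≤j j≢1))

  image-InF2 : (x : C2 L s k n) → InF2 L s k n (image x)
  image-InF2 x@(ps , ((_ , positive , total) , range) , no-k , _) =
    ( ( transfer-decreasing s i enough
      , transfer-All s i enough 1≤s (≤-trans 1≤s (<⇒≤ s<is)) positive
      , trans (transfer-sum s i enough) total )
    , transfer-∈ s i enough
    , transfer-All s i enough (≤-refl , m≤m+n s L) (<⇒≤ s<is , is≤s+L) (All.map weaken range)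
    , transfer-absent s i enough k (<⇒≢ (<-trans s<is is<k)) (<⇒≢ is<k) no-k )
    , transfer-small-once s i enough (>⇒≢ s<is) no-s
    , (i , 2≤row x , row-once x , other-multiples-absent x)
    where
    i = row x
    enough = copies x
    s<is = s<row*s x
    is<k = <-≤-trans (row*s<L x) L≤k
    is≤s+L = ≤-trans (<⇒≤ (row*s<L x)) (m≤n+m L s)
    weaken : ∀ {p} → s + 1 ≤ p × p ≤ s + L → s ≤ p × p ≤ s + L
    weaken (s+1≤p , p≤) = ≤-trans (m≤m+n s 1) s+1≤p , p≤
    -- every part of x exceeds s
    no-s : mult s ps ≡ 0
    no-s = mult-absent s (All.map (λ (s+1≤p , _) → above-s s+1≤p) range)
      where
      above-s : ∀ {p} → s + 1 ≤ p → ¬ p ≡ s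
      above-s {p} s+1≤p p≡s = <-irrefl (sym p≡s) (subst (_≤ p) (+-comm s 1) s+1≤p)

  φ : C2 L s k n → F2 L s k n
  φ x = image x , image-InF2 x

  -- The image determines the row (it is the unique i with g_{is} = 1) and then,
  -- by injectivity of transfer, the partition itself.
  φ-injective : IsInjection φ
  φ-injective x y eq = transfer-injective s (row y) (decreasing x) (decreasing y)
                         (subst (λ r → s ≤ mult (suc r) (proj₁ x)) same-row (copies x)) (copies y)
                         (trans (cong (λ r → transfer s r (proj₁ x)) (sym same-row)) eq)
    where
    same-row : row x ≡ row y
    same-row = F2-row-unique {s} {ps = image y} (2≤row x)
                 (subst (λ ps → mult (row x * s) ps ≡ 1) eq (row-once x))
                 (other-multiples-absent y)

-- Every part is a multiple of 1, so the condition f_{a·1} = 0 for a ≥ 2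
-- contradicts f_j ≥ 1 for some j ≥ 2: C² is empty.
C2-empty-at-1 : ∀ {L k n} → ¬ C2 L 1 k n
C2-empty-at-1 (ps , _ , _ , no-multiples , j , 2≤j , _ , copies) =
  contradiction (trans (cong (λ t → mult t ps) (sym (*-identityʳ j))) (no-multiples j 2≤j))
                (λ none → contradiction (subst (1 ≤_) none copies) λ ())

lemma2p4 : (s L k n : ℕ) → 1 ≤ s → 2 * s ^ 3 + 5 * s ^ 2 + 1 ≤ L → L ≤ k → k ≤ s + L
    → 2 * s ^ 5 + 8 * s ^ 4 + s ^ 3 + 3 * s + 1 ≤ n + 14 * s ^ 2
    → Σ (C2 L s k n → F2 L s k n) IsInjection
lemma2p4 zero L k n () _ _ _ _
lemma2p4 (suc zero) L k n _ _ _ _ _ =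
  (λ x → ⊥-elim (C2-empty-at-1 x)) , (λ x _ _ → ⊥-elim (C2-empty-at-1 x))
lemma2p4 s@(suc (suc _)) L k n _ hL L≤k _ _ = φ , φ-injective
  where open Construction s L k n (s≤s (s≤s z≤n)) hL L≤k
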